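{- Let $L$ be a circle component and $ab$ a chord of $C_n$. Then some chord of $L$ crosses $ab$ if and only if (1) $ab$ is an internal chord of $L$, or (2) $ab$ crosses some border chord of $L$.
   Context: Let $n\ge 4$ and let $C_n$ be the cycle on $[n]$ with edges $\{i,i+1\}$ and $\{n,1\}$. A chord is an edge between two non-consecutive vertices of $C_n$. Chords $ab$, $cd$ with $a<b$, $c<d$ cross if $a,b,c,d$ are distinct and $c<a<d<b$ or $a<c<b<d$. For a set $L$ of chords, $V(L)$ is the set of vertices incident to a chord of $L$; its circle graph has vertex set $L$, two chords adjacent iff they cross; $L$ is a circle component if its circle graph is connected. Writing $V(L)=\{v_1<v_2<\dots<v_r\}$, the pairs $v_i,v_{i+1}$ (indices modulo $r$) are consecutive in $V(L)$. Chords of $C_n$ between non-consecutive vertices of $V(L)$ are internal chords of $L$; chords of $C_n$ between consecutive vertices of $V(L)$ are border chords of $L$. -}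

module Defs where

open import Data.Nat using (ℕ; suc; _≤_; _<_)
open import Data.Product using (_×_; _,_; Σ; ∃; ∃-syntax)
open import Data.Sum using (_⊎_)
open import Data.List using (List)
open import Data.List.Membership.Propositional using (_∈_)
open import Relation.Binary.PropositionalEquality using (_≡_)
open import Relation.Binary.Construct.Closure.ReflexiveTransitive using (Star)
open import Relation.Nullary using (¬_)

-- Vertices of C_n are the naturals 1..n.  A chord is represented by the
-- pair (a , b) of its endpoints with a < b.
Edge : Set
Edge = ℕ × ℕ

-- ab is a chord of C_n: 1 ≤ a < b ≤ n, and a, b are not consecutive on C_n
-- (i.e. b ≠ a+1 and {a,b} ≠ {1,n}).
IsChord : ℕ → Edge → Set
IsChord n (a , b) = 1 ≤ a × a < b × b ≤ n × ¬ (b ≡ suc a) × ¬ (a ≡ 1 × b ≡ n)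

Cross : Edge → Edge → Set
Cross (a , b) (c , d) = (c < a × a < d × d < b) ⊎ (a < c × c < b × b < d)

InV : List Edge → ℕ → Set
InV L v = ∃[ e ] (e ∈ L × (Data.Product.proj₁ e ≡ v ⊎ Data.Product.proj₂ e ≡ v))

CircleAdj : List Edge → Edge → Edge → Set
CircleAdj L e f = e ∈ L × f ∈ L × Cross e f

CircleComponent : List Edge → Set
CircleComponent L = ∀ e f → e ∈ L → f ∈ L → Star (CircleAdj L) e f

-- u < w are consecutive in V(L) = {v₁ < … < v_r}: either w = v_{i+1}
-- for u = v_i (no vertex of V(L) strictly between), or {u,w} = {v_r, v₁}
-- (u is the minimum and w the maximum of V(L)).
ConsecV : List Edge → ℕ → ℕ → Set
ConsecV L u w =
  InV L u × InV L w × u < w ×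
  ((∀ v → InV L v → ¬ (u < v × v < w)) ⊎ (∀ v → InV L v → u ≤ v × v ≤ w))

InternalChord : ℕ → List Edge → Edge → Set
InternalChord n L (a , b) = IsChord n (a , b) × InV L a × InV L b × ¬ ConsecV L a b

BorderChord : ℕ → List Edge → Edge → Set
BorderChord n L (a , b) = IsChord n (a , b) × ConsecV L a b

-- Everything is governed by the two sides of ab: call L straddling ab when V(L) has a vertex
-- strictly between a and b and a vertex outside [a, b].  A crossing chord of L straddles ab;
-- conversely, in a connected circle graph a walk from a chord with an endpoint between a and b
-- to a chord with an endpoint outside either meets a crossing chord or keeps all its chords
-- inside [a, b], which the last chord forbids.  On the other side, an internal chord ab
-- straddles by the very definition of consecutiveness, a crossed border chord has one endpoint
-- on each side, and if L straddles ab while, say, a ∉ V(L), then the border chord spanning the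
-- gap of V(L) around a crosses ab.
module Submission where

open import Defs
open import Data.Nat using (ℕ; suc; s≤s; _≤_; _<_; _≤?_; _<?_)
open import Data.Nat.Properties
open import Data.Product using (_×_; _,_; proj₁; proj₂; ∃-syntax)
open import Data.Sum using (_⊎_; inj₁; inj₂; [_,_]; swap)
open import Data.List using (List; []; _∷_)
open import Data.List.Membership.Propositional using (_∈_; find; lose)
open import Data.List.Membership.DecPropositional _≟_ using (_∈?_)
open import Data.List.Relation.Unary.All using (All)
import Data.List.Relation.Unary.All as All
open import Data.List.Relation.Unary.Any using (here; there; any?)
open import Data.Unit using (⊤; tt)
open import Function using (flip)
open import Function.Bundles using (_⇔_; mk⇔)
open import Relation.Binary.Definitions using (Total; Transitive; tri<; tri≈; tri>)
open import Relation.Binary.PropositionalEquality using (_≡_; refl)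
open import Relation.Binary.Construct.Closure.ReflexiveTransitive using (Star; ε; _◅_)
open import Relation.Nullary using (¬_; Dec; yes; no; contradiction)
open import Relation.Nullary.Decidable using (map′; _⊎-dec_; _×-dec_)
open import Level using (0ℓ)
open import Relation.Unary using (Pred; Decidable)

module _ {A : Set} {_≼_ : A → A → Set} (total : Total _≼_) (trans : Transitive _≼_) where

  ≼-refl : ∀ x → x ≼ x
  ≼-refl x with total x x
  ... | inj₁ x≼x = x≼x
  ... | inj₂ x≼x = x≼x

  greatest : {P : Pred A 0ℓ} → Decidable P → (xs : List A) →
    (∀ x → x ∈ xs → ¬ P x) ⊎ ∃[ u ] (u ∈ xs × P u × (∀ x → x ∈ xs → P x → x ≼ u))
  greatest P? [] = inj₁ λ _ ()
  greatest P? (y ∷ xs) with P? y | greatest P? xs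
  ... | no ¬py | inj₁ none =
    inj₁ λ { _ (here refl) → ¬py ; x (there x∈) → none x x∈ }
  ... | no ¬py | inj₂ (u , u∈ , pu , top) =
    inj₂ (u , there u∈ , pu , λ { _ (here refl) py → contradiction py ¬py ; x (there x∈) → top x x∈ })
  ... | yes py | inj₁ none =
    inj₂ (y , here refl , py , λ { _ (here refl) _ → ≼-refl y ; x (there x∈) px → contradiction px (none x x∈) })
  ... | yes py | inj₂ (u , u∈ , pu , top) with total y u
  ...   | inj₁ y≼u = inj₂ (u , there u∈ , pu , λ { _ (here refl) _ → y≼u ; x (there x∈) → top x x∈ })
  ...   | inj₂ u≼y = inj₂ (y , here refl , py , λ { _ (here refl) _ → ≼-refl y ; x (there x∈) px → trans (top x x∈ px) u≼y })

vertices : List Edge → List ℕ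
vertices [] = []
vertices ((c , d) ∷ L) = c ∷ d ∷ vertices L

module _ {L : List Edge} where

  ∈vertices⇒InV : ∀ {v} → v ∈ vertices L → InV L v
  ∈vertices⇒InV {v} = go L
    where
    go : ∀ L → v ∈ vertices L → InV L v
    go ((c , d) ∷ L) (here refl) = (c , d) , here refl , inj₁ refl
    go ((c , d) ∷ L) (there (here refl)) = (c , d) , here refl , inj₂ refl
    go (_ ∷ L) (there (there v∈)) with go L v∈
    ... | e , e∈L , v∈e = e , there e∈L , v∈e

  InV⇒∈vertices : ∀ {v} → InV L v → v ∈ vertices L
  InV⇒∈vertices (e , e∈L , v∈e) = go L e∈L v∈e
    where
    go : ∀ {v e} L → e ∈ L → (proj₁ e ≡ v ⊎ proj₂ e ≡ v) → v ∈ vertices L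
    go (_ ∷ L) (here refl) (inj₁ refl) = here refl
    go (_ ∷ L) (here refl) (inj₂ refl) = there (here refl)
    go (_ ∷ L) (there e∈L) v∈e = there (there (go L e∈L v∈e))

  InV? : Decidable (InV L)
  InV? v = map′ ∈vertices⇒InV InV⇒∈vertices (v ∈? vertices L)

  anyVertex? : {P : Pred ℕ 0ℓ} → Decidable P → Dec (∃[ v ] (InV L v × P v))
  anyVertex? P? = map′ (λ p → let (v , v∈ , pv) = find p in v , ∈vertices⇒InV v∈ , pv)
                       (λ { (v , iv , pv) → lose (InV⇒∈vertices iv) pv })
                       (any? P? (vertices L))

  extremalVertex : {_≼_ : ℕ → ℕ → Set} → Total _≼_ → Transitive _≼_ →
    {P : Pred ℕ 0ℓ} → Decidable P →
    (∀ v → InV L v → ¬ P v) ⊎ ∃[ u ] (InV L u × P u × (∀ v → InV L v → P v → v ≼ u))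
  extremalVertex total trans P? with greatest total trans P? (vertices L)
  ... | inj₁ none = inj₁ λ v iv → none v (InV⇒∈vertices iv)
  ... | inj₂ (u , u∈ , pu , top) = inj₂ (u , ∈vertices⇒InV u∈ , pu , λ v iv → top v (InV⇒∈vertices iv))

  maxVertex : {P : Pred ℕ 0ℓ} → Decidable P →
    (∀ v → InV L v → ¬ P v) ⊎ ∃[ u ] (InV L u × P u × (∀ v → InV L v → P v → v ≤ u))
  maxVertex = extremalVertex ≤-total ≤-trans

  minVertex : {P : Pred ℕ 0ℓ} → Decidable P →
    (∀ v → InV L v → ¬ P v) ⊎ ∃[ u ] (InV L u × P u × (∀ v → InV L v → P v → u ≤ v))
  minVertex = extremalVertex (flip ≤-total) (flip ≤-trans)

  vertexRange : ∀ {v₀} → InV L v₀ → ∃[ u ] ∃[ w ] (InV L u × InV L w × (∀ v → InV L v → u ≤ v × v ≤ w))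
  vertexRange {v₀} iv₀ with minVertex {P = λ _ → ⊤} (λ _ → yes tt) | maxVertex {P = λ _ → ⊤} (λ _ → yes tt)
  ... | inj₁ none | _ = contradiction tt (none v₀ iv₀)
  ... | inj₂ _ | inj₁ none = contradiction tt (none v₀ iv₀)
  ... | inj₂ (u , iu , _ , bot) | inj₂ (w , iw , _ , top) = u , w , iu , iw , λ v iv → bot v iv tt , top v iv tt

  gapAround : ∀ {x u w} → ¬ InV L x →
    (∀ v → InV L v → v < x → v ≤ u) → (∀ v → InV L v → x < v → w ≤ v) →
    ∀ v → InV L v → ¬ (u < v × v < w)
  gapAround {x} x∉V below above v iv (u<v , v<w) with <-cmp v x
  ... | tri< v<x _ _ = <⇒≱ u<v (below v iv v<x)
  ... | tri≈ _ refl _ = x∉V iv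
  ... | tri> _ _ x<v = <⇒≱ v<w (above v iv x<v)

endpoint-satisfies : ∀ {P : Pred ℕ 0ℓ} {e v} → (proj₁ e ≡ v ⊎ proj₂ e ≡ v) → P v → P (proj₁ e) ⊎ P (proj₂ e)
endpoint-satisfies (inj₁ refl) pv = inj₁ pv
endpoint-satisfies (inj₂ refl) pv = inj₂ pv

Between : ℕ → ℕ → Pred ℕ 0ℓ
Between a b v = a < v × v < b

Beyond : ℕ → ℕ → Pred ℕ 0ℓ
Beyond a b v = v < a ⊎ b < v

Straddles : List Edge → ℕ → ℕ → Set
Straddles L a b = (∃[ v ] (InV L v × Between a b v)) × (∃[ w ] (InV L w × Beyond a b w))

CrossingChord : List Edge → ℕ → ℕ → Set
CrossingChord L a b = ∃[ e ] (e ∈ L × Cross e (a , b))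

¬beyond⇒within : ∀ {a b v} → ¬ Beyond a b v → a ≤ v × v ≤ b
¬beyond⇒within v∉ = ≮⇒≥ (λ v<a → v∉ (inj₁ v<a)) , ≮⇒≥ (λ b<v → v∉ (inj₂ b<v))

cross⇒sides : ∀ {a b c d} → Cross (c , d) (a , b) →
  (Between a b c × Beyond a b d) ⊎ (Beyond a b c × Between a b d)
cross⇒sides (inj₁ (a<c , c<b , b<d)) = inj₁ ((a<c , c<b) , inj₂ b<d)
cross⇒sides (inj₂ (c<a , a<d , d<b)) = inj₂ (inj₁ c<a , (a<d , d<b))

cross⇒straddles : ∀ {L a b c d} → InV L c → InV L d → Cross (c , d) (a , b) → Straddles L a b
cross⇒straddles ic id cr with cross⇒sides cr
... | inj₁ (c-btw , d-bey) = (_ , ic , c-btw) , (_ , id , d-bey)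
... | inj₂ (c-bey , d-btw) = (_ , id , d-btw) , (_ , ic , c-bey)

crossingChord⇒straddles : ∀ {L a b} → CrossingChord L a b → Straddles L a b
crossingChord⇒straddles (e , e∈L , cr) = cross⇒straddles (e , e∈L , inj₁ refl) (e , e∈L , inj₂ refl) cr

straddles⇒¬ConsecV : ∀ {L a b} → Straddles L a b → ¬ ConsecV L a b
straddles⇒¬ConsecV ((v , iv , v-btw) , _) (_ , _ , _ , inj₁ noneBetween) = noneBetween v iv v-btw
straddles⇒¬ConsecV (_ , (w , iw , inj₁ w<a)) (_ , _ , _ , inj₂ within) = <⇒≱ w<a (proj₁ (within w iw))
straddles⇒¬ConsecV (_ , (w , iw , inj₂ b<w)) (_ , _ , _ , inj₂ within) = <⇒≱ b<w (proj₂ (within w iw))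

internal⇒straddles : ∀ {n L a b} → InternalChord n L (a , b) → Straddles L a b
internal⇒straddles {L = L} {a} {b} ((_ , a<b , _) , ia , ib , ¬consec)
  with anyVertex? {L = L} (λ v → (a <? v) ×-dec (v <? b))
     | anyVertex? {L = L} (λ v → (v <? a) ⊎-dec (b <? v))
... | yes between | yes beyond = between , beyond
... | no ¬between | _ = contradiction (ia , ib , a<b , inj₁ λ v iv v-btw → ¬between (v , iv , v-btw)) ¬consec
... | yes _ | no ¬beyond = contradiction (ia , ib , a<b , inj₂ λ v iv → ¬beyond⇒within λ v-bey → ¬beyond (v , iv , v-bey)) ¬consec

module Propagation {n : ℕ} {L : List Edge} (chords : All (IsChord n) L) (a b : ℕ) where

  TouchesBetween : Edge → Set
  TouchesBetween e = Between a b (proj₁ e) ⊎ Between a b (proj₂ e)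

  Spanned : Edge → Set
  Spanned e = a ≤ proj₁ e × proj₂ e ≤ b

  touches⇒cross⊎spanned : ∀ {c d} → c < d → TouchesBetween (c , d) → Cross (c , d) (a , b) ⊎ Spanned (c , d)
  touches⇒cross⊎spanned {d = d} c<d (inj₁ (a<c , c<b)) with d ≤? b
  ... | yes d≤b = inj₂ (<⇒≤ a<c , d≤b)
  ... | no d≰b = inj₁ (inj₁ (a<c , c<b , ≰⇒> d≰b))
  touches⇒cross⊎spanned {c = c} c<d (inj₂ (a<d , d<b)) with a ≤? c
  ... | yes a≤c = inj₂ (a≤c , <⇒≤ d<b)
  ... | no a≰c = inj₁ (inj₂ (≰⇒> a≰c , a<d , d<b))

  -- A chord crossing cd has an endpoint strictly between c and d, hence strictly between a and b.
  spanned-cross⇒touches : ∀ {c d x y} → Spanned (c , d) → Cross (c , d) (x , y) → TouchesBetween (x , y)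
  spanned-cross⇒touches (a≤c , d≤b) (inj₁ (x<c , c<y , y<d)) = inj₂ (≤-<-trans a≤c c<y , <-≤-trans y<d d≤b)
  spanned-cross⇒touches (a≤c , d≤b) (inj₂ (c<x , x<d , d<y)) = inj₁ (≤-<-trans a≤c c<x , <-≤-trans x<d d≤b)

  spanned⇒¬touchesBeyond : ∀ {c d} → c < d → Spanned (c , d) → ¬ (Beyond a b c ⊎ Beyond a b d)
  spanned⇒¬touchesBeyond c<d (a≤c , d≤b) (inj₁ (inj₁ c<a)) = <⇒≱ c<a a≤c
  spanned⇒¬touchesBeyond c<d (a≤c , d≤b) (inj₁ (inj₂ b<c)) = <⇒≱ (<-trans b<c c<d) d≤b
  spanned⇒¬touchesBeyond c<d (a≤c , d≤b) (inj₂ (inj₁ d<a)) = <⇒≱ (≤-<-trans a≤c c<d) (<⇒≤ d<a)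
  spanned⇒¬touchesBeyond c<d (a≤c , d≤b) (inj₂ (inj₂ b<d)) = <⇒≱ b<d d≤b

  endpoints< : ∀ {e} → e ∈ L → proj₁ e < proj₂ e
  endpoints< e∈L = proj₁ (proj₂ (All.lookup chords e∈L))

  propagate : ∀ {e f} → Star (CircleAdj L) e f → e ∈ L → TouchesBetween e → CrossingChord L a b ⊎ Spanned f
  propagate {e} path e∈L t with touches⇒cross⊎spanned (endpoints< e∈L) t
  ... | inj₁ cr = inj₁ (e , e∈L , cr)
  propagate ε _ _ | inj₂ sp = inj₂ sp
  propagate ((_ , f∈L , cr) ◅ path) _ _ | inj₂ sp = propagate path f∈L (spanned-cross⇒touches sp cr)

  straddles⇒crossingChord : CircleComponent L → Straddles L a b → CrossingChord L a b
  straddles⇒crossingChord conn ((_ , (e , e∈L , v∈e) , v-btw) , (_ , (f , f∈L , w∈f) , w-bey))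
    with propagate (conn e f e∈L f∈L) e∈L (endpoint-satisfies v∈e v-btw)
  ... | inj₁ crossing = crossing
  ... | inj₂ sp = contradiction (endpoint-satisfies w∈f w-bey) (spanned⇒¬touchesBeyond (endpoints< f∈L) sp)

module Borders {n : ℕ} {L : List Edge} (chords : All (IsChord n) L) where

  chordAt : ∀ {v} → InV L v → ∃[ c ] ∃[ d ] ((c , d) ∈ L × IsChord n (c , d) × InV L c × InV L d)
  chordAt ((c , d) , e∈L , _) = c , d , e∈L , All.lookup chords e∈L , ((c , d) , e∈L , inj₁ refl) , ((c , d) , e∈L , inj₂ refl)

  InV-bounds : ∀ {v} → InV L v → 1 ≤ v × v ≤ n
  InV-bounds ((c , d) , e∈L , v∈e) with All.lookup chords e∈L | v∈e
  ... | 1≤c , c<d , d≤n , _ | inj₁ refl = 1≤c , ≤-trans (<⇒≤ c<d) d≤n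
  ... | 1≤c , c<d , d≤n , _ | inj₂ refl = ≤-trans 1≤c (<⇒≤ c<d) , d≤n

  -- The only vertices of a chord are 1 and n when V(L) avoids (1, n); but 1n is not a chord.
  gap1n⇒¬InV : (∀ v → InV L v → ¬ (1 < v × v < n)) → ∀ {v} → ¬ InV L v
  gap1n⇒¬InV noneBetween iv with chordAt iv
  ... | c , d , _ , (1≤c , c<d , d≤n , _ , ¬1n) , ic , id =
    ¬1n (≤-antisym (≮⇒≥ λ 1<c → noneBetween c ic (1<c , <-≤-trans c<d d≤n)) 1≤c ,
         ≤-antisym d≤n (≮⇒≥ λ d<n → noneBetween d id (≤-<-trans 1≤c c<d , d<n)))

  gap⇒border : ∀ {x u w} → InV L u → InV L w → u < x → x < w →
    (∀ v → InV L v → ¬ (u < v × v < w)) → BorderChord n L (u , w)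
  gap⇒border {x} {u} {w} iu iw u<x x<w noneBetween =
    (proj₁ (InV-bounds iu) , u<w , proj₂ (InV-bounds iw) , w≢1+u , ¬1n) , (iu , iw , u<w , inj₁ noneBetween)
    where
    u<w : u < w
    u<w = <-trans u<x x<w
    w≢1+u : ¬ (w ≡ suc u)
    w≢1+u refl = <⇒≱ x<w u<x
    ¬1n : ¬ (u ≡ 1 × w ≡ n)
    ¬1n (refl , refl) = gap1n⇒¬InV noneBetween iu

  span⇒border : ∀ {u w} → InV L u → InV L w → (∀ v → InV L v → u ≤ v × v ≤ w) →
    ¬ (u ≡ 1 × w ≡ n) → BorderChord n L (u , w)
  span⇒border {u} {w} iu iw within ¬1n with chordAt iu
  ... | c , d , _ , (_ , c<d , _ , d≢1+c , _) , ic , id =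
    (proj₁ (InV-bounds iu) , u<w , proj₂ (InV-bounds iw) , w≢1+u , ¬1n) , (iu , iw , u<w , inj₂ within)
    where
    u≤c : u ≤ c
    u≤c = proj₁ (within c ic)
    d≤w : d ≤ w
    d≤w = proj₂ (within d id)
    u<w : u < w
    u<w = ≤-<-trans u≤c (<-≤-trans c<d d≤w)
    w≢1+u : ¬ (w ≡ suc u)
    w≢1+u refl = d≢1+c (≤-antisym (≤-trans d≤w (s≤s u≤c)) c<d)

  CrossedBorder : ℕ → ℕ → Set
  CrossedBorder a b = ∃[ f ] (BorderChord n L f × Cross (a , b) f)

  crossedBorderAtLeft : ∀ {a b} → 1 ≤ a → ¬ InV L a → Straddles L a b → CrossedBorder a b
  crossedBorderAtLeft {a} {b} 1≤a a∉V ((p , ip , a<p , p<b) , (q , iq , q-bey)) with maxVertex {L = L} (_<? a)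
  ... | inj₂ (u , iu , u<a , below) with minVertex {L = L} (a <?_)
  ...   | inj₁ noneAbove = contradiction a<p (noneAbove p ip)
  ...   | inj₂ (w , iw , a<w , above) =
    (u , w) , gap⇒border iu iw u<a a<w (gapAround a∉V below above) , inj₁ (u<a , a<w , ≤-<-trans (above p ip a<p) p<b)
  crossedBorderAtLeft {a} {b} 1≤a a∉V ((p , ip , a<p , p<b) , (q , iq , q-bey)) | inj₁ noneBelow
    with vertexRange ip
  ... | u , w , iu , iw , within = (u , w) , span⇒border iu iw within ¬1n , inj₂ (a<u , ≤-<-trans (proj₁ (within p ip)) p<b , b<w)
    where
    a<u : a < u
    a<u = ≤∧≢⇒< (≮⇒≥ (noneBelow u iu)) λ { refl → a∉V iu }
    b<w : b < w
    b<w = [ (λ q<a → contradiction q<a (noneBelow q iq)) , (λ b<q → <-≤-trans b<q (proj₂ (within q iq))) ] q-bey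
    ¬1n : ¬ (u ≡ 1 × w ≡ n)
    ¬1n (refl , _) = <⇒≱ a<u 1≤a

  crossedBorderAtRight : ∀ {a b} → b ≤ n → ¬ InV L b → Straddles L a b → CrossedBorder a b
  crossedBorderAtRight {a} {b} b≤n b∉V ((p , ip , a<p , p<b) , (q , iq , q-bey)) with minVertex {L = L} (b <?_)
  ... | inj₂ (w , iw , b<w , above) with maxVertex {L = L} (_<? b)
  ...   | inj₁ noneBelow = contradiction p<b (noneBelow p ip)
  ...   | inj₂ (u , iu , u<b , below) =
    (u , w) , gap⇒border iu iw u<b b<w (gapAround b∉V below above) , inj₂ (<-≤-trans a<p (below p ip p<b) , u<b , b<w)
  crossedBorderAtRight {a} {b} b≤n b∉V ((p , ip , a<p , p<b) , (q , iq , q-bey)) | inj₁ noneAbove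
    with vertexRange ip
  ... | u , w , iu , iw , within = (u , w) , span⇒border iu iw within ¬1n , inj₁ (u<a , <-≤-trans a<p (proj₂ (within p ip)) , w<b)
    where
    w<b : w < b
    w<b = ≤∧≢⇒< (≮⇒≥ (noneAbove w iw)) λ { refl → b∉V iw }
    u<a : u < a
    u<a = [ (λ q<a → ≤-<-trans (proj₁ (within q iq)) q<a) , (λ b<q → contradiction b<q (noneAbove q iq)) ] q-bey
    ¬1n : ¬ (u ≡ 1 × w ≡ n)
    ¬1n (_ , refl) = <⇒≱ w<b b≤n

  straddles⇒internal⊎crossedBorder : ∀ {a b} → IsChord n (a , b) → Straddles L a b →
    InternalChord n L (a , b) ⊎ CrossedBorder a b
  straddles⇒internal⊎crossedBorder {a} {b} ab s with InV? {L = L} a | InV? {L = L} b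
  ... | yes ia | yes ib = inj₁ (ab , ia , ib , straddles⇒¬ConsecV s)
  ... | no a∉V | _ = inj₂ (crossedBorderAtLeft (proj₁ ab) a∉V s)
  ... | yes _ | no b∉V = inj₂ (crossedBorderAtRight (proj₁ (proj₂ (proj₂ ab))) b∉V s)

  internal⊎crossedBorder⇒straddles : ∀ {a b} → InternalChord n L (a , b) ⊎ CrossedBorder a b → Straddles L a b
  internal⊎crossedBorder⇒straddles (inj₁ internal) = internal⇒straddles internal
  internal⊎crossedBorder⇒straddles (inj₂ (_ , (_ , iu , iw , _) , cr)) = cross⇒straddles iu iw (swap cr)

lemma5 : (n : ℕ) → 4 ≤ n → (L : List Edge) → All (IsChord n) L → CircleComponent L →
    (a b : ℕ) → IsChord n (a , b) →
    ((∃[ e ] (e ∈ L × Cross e (a , b))) ⇔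
      (InternalChord n L (a , b) ⊎ (∃[ f ] (BorderChord n L f × Cross (a , b) f))))
lemma5 n _ L chords conn a b ab = mk⇔
  (λ crossing → straddles⇒internal⊎crossedBorder ab (crossingChord⇒straddles crossing))
  (λ h → straddles⇒crossingChord conn (internal⊎crossedBorder⇒straddles h))
  where
  open Borders chords
  open Propagation chords a b
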